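{- Let $g(x)=\sum_{n\ge0}g_nx^n$ be a formal power series over $\mathbb{C}$ with $g_0=1$ such that the Riordan matrix $(1,xg(x))$ is a pseudo-involution, i.e. the compositional inverse of the series $xg(x)$ is $xg(-x)$ (equivalently $(1,xg(x))^{ -1}=(1,-x)(1,xg(x))(1,-x)=(1,xg(-x))$). Let $\sqrt{g(x)}$ denote the formal power series with constant term $1$ whose square is $g(x)$, and let $h(x)$ be the generating function of the $A$-sequence of the matrix $(1,x\sqrt{g(x)})$, i.e. the unique formal power series satisfying $h\big(x\sqrt{g(x)}\big)=\sqrt{g(x)}$. Then $$(1,xg(x))=\big(1,x\sqrt{g(x)}\big)\,(1,xh(x)),$$ and $h$ satisfies $h(-x)=h^{ -1}(x)$ (i.e. $h(x)h(-x)=1$) and $h(x)=s(x)+\sqrt{s^2(x)+1}$ for some formal power series $s(x)=\sum_n s_nx^n$ with $s_{2n}=0$ for all $n\ge 0$.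
   Context: For a formal power series $f$ with $f_0=0$, the Riordan matrix $(1,f(x))$ is the infinite lower triangular matrix acting on formal power series by $(1,f(x))a(x)=a(f(x))$; its $n$-th column has generating function $f^n(x)$. Products satisfy $(1,f(x))(1,k(x))=(1,k(f(x)))$, and $(1,f)^{ -1}=(1,\bar f)$ where $\bar f$ is the compositional inverse of $f$. For a series $s$ with $s_0=0$, $\sqrt{s^2(x)+1}$ denotes the square root with constant term $1$. For a matrix $(1,xg(x))$ with $g_0\neq0$, its $A$-sequence generating function $A(x)$ is the unique series with $g(x)=A(xg(x))$. -}

module Defs where

open import Level using (Level; _⊔_)
open import Data.Nat using (ℕ; zero; suc; _∸_) renaming (_*_ to _*ℕ_)
open import Data.Product using (∃)
open import Relation.Nullary using (¬_)
open import Algebra.Bundles using (CommutativeRing)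

-- Coefficient field: a commutative ring that is a field of characteristic 0
-- (ℂ is the paper's instance; stdlib has neither ℂ nor a Field bundle).
-- n ↦ 1# + ... + 1# (n times) in R
natCast : {c ℓ : Level} (R : CommutativeRing c ℓ) → ℕ → CommutativeRing.Carrier R
natCast R zero    = CommutativeRing.0# R
natCast R (suc n) = CommutativeRing._+_ R (CommutativeRing.1# R) (natCast R n)

record IsFieldChar0 {c ℓ : Level} (R : CommutativeRing c ℓ) : Set (c ⊔ ℓ) where
  open CommutativeRing R hiding (zero)
  field
    nontrivial : ¬ (1# ≈ 0#)
    inverse    : ∀ x → ¬ (x ≈ 0#) → ∃ λ y → x * y ≈ 1#
    char0      : ∀ n → ¬ (natCast R (suc n) ≈ 0#)

module FPS {c ℓ : Level} (R : CommutativeRing c ℓ) where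
  open CommutativeRing R hiding (zero)

  Series : Set c
  Series = ℕ → Carrier

  infix 4 _≈ₛ_
  _≈ₛ_ : Series → Series → Set ℓ
  a ≈ₛ b = ∀ n → a n ≈ b n

  sumTo : ℕ → (ℕ → Carrier) → Carrier
  sumTo zero    f = 0#
  sumTo (suc n) f = sumTo n f + f n

  oneₛ : Series
  oneₛ zero    = 1#
  oneₛ (suc n) = 0#

  X : Series
  X zero          = 0#
  X (suc zero)    = 1#
  X (suc (suc n)) = 0#

  _+ₛ_ : Series → Series → Series
  (a +ₛ b) n = a n + b n

  _*ₛ_ : Series → Series → Series
  (a *ₛ b) n = sumTo (suc n) (λ i → a i * b (n ∸ i))

  xTimes : Series → Series
  xTimes a zero    = 0#
  xTimes a (suc n) = a n

  -- a(-x)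
  negArg : Series → Series
  negArg a zero          = a zero
  negArg a (suc zero)    = - a (suc zero)
  negArg a (suc (suc n)) = negArg (λ m → a (suc (suc m))) n

  powₛ : Series → ℕ → Series
  powₛ f zero    = oneₛ
  powₛ f (suc k) = f *ₛ powₛ f k

  -- composition a(f(x)), meaningful for f with f 0 ≈ 0
  -- (then [x^n] f^k = 0 for k > n, so the sum is the full sum)
  _∘ₛ_ : Series → Series → Series
  (a ∘ₛ f) n = sumTo (suc n) (λ k → a k * powₛ f k n)

  Matrix : Set c
  Matrix = ℕ → ℕ → Carrier

  infix 4 _≈ₘ_
  _≈ₘ_ : Matrix → Matrix → Set ℓ
  A ≈ₘ B = ∀ n k → A n k ≈ B n k

  -- product of lower triangular matrices
  _·ₘ_ : Matrix → Matrix → Matrix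
  (A ·ₘ B) n k = sumTo (suc n) (λ j → A n j * B j k)

  -- the Riordan matrix (1, f(x)): n-th column has generating function f^n
  riordan : Series → Matrix
  riordan f n k = powₛ f k n

  evenCoeffsZero : Series → Set ℓ
  evenCoeffsZero s = ∀ n → s (2 *ℕ n) ≈ 0#

-- Write f = x g, u = x r and v = x h. Since (1, u)(1, v) = (1, v ∘ u), the factorisation is
-- v ∘ u = u · (h ∘ u) = u r = x r² = f. For the reciprocity, the pseudo-involution
-- x g(-x) ∘ f = x turns into f ∘ (-f) = -x. Then u ∘ (-f) and -u are both square roots of
-- (x f) ∘ (-f) = x f = u² with linear coefficient -1; as 2 is invertible such a root is unique,
-- so u ∘ (-f) = -u and v ∘ (-u) = (v ∘ u) ∘ (-f) = f ∘ (-f) = -x, i.e. r · h(-u) = 1. This says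
-- that h(x) h(-x) becomes 1 after substituting u, and substituting u is injective. Finally
-- s = (h - h(-x))/2 and t = (h + h(-x))/2 satisfy t² - s² = h(x) h(-x) = 1.

module Submission where

open import Defs
open import Level using (Level; _⊔_)
open import Data.Nat using (ℕ; zero; suc; _∸_; _<_; _≤_; z≤n; s≤s) renaming (_*_ to _*ℕ_)
import Data.Nat as ℕ
open import Data.Nat.Properties using (m∸n≤m; ≤-refl; ≤-trans; n≤1+n; m≤n⇒m<n∨m≡n; m∸[m∸n]≡n; *-suc)
import Data.Nat.Properties as ℕ
open import Data.Nat.Induction using (<-rec)
open import Data.Integer as ℤ using (ℤ; +_; -[1+_]; _⊖_; ∣_∣; sign; _◃_)
import Data.Integer.Properties as ℤ
open import Data.Sign as Sign using (Sign)
open import Data.Maybe using (map)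
open import Data.Product using (∃; _×_; _,_)
open import Data.Sum using (inj₁; inj₂)
open import Relation.Nullary.Decidable using (dec⇒maybe)
import Relation.Binary.PropositionalEquality as ≡
open import Algebra.Bundles using (CommutativeRing)
import Algebra.Construct.Pointwise as Pointwise
open import Algebra.Solver.Ring.AlmostCommutativeRing using (fromCommutativeRing; _-Raw-AlmostCommutative⟶_)
import Algebra.Solver.Ring
import Algebra.Properties.Ring
import Algebra.Properties.AbelianGroup
import Algebra.Properties.CommutativeSemigroup
import Algebra.Properties.Group
import Algebra.Properties.Semiring.Mult
import Relation.Binary.Reasoning.Setoid

-- ℤ maps into every commutative ring, so it can serve as the coefficient ring of the solver.
module IntegerCoefficientSolver {c ℓ : Level} (R : CommutativeRing c ℓ) where
  open CommutativeRing R hiding (zero)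
  open Algebra.Properties.Ring ring using (-1*x≈-x; -‿involutive; -0#≈0#)
  open Algebra.Properties.AbelianGroup +-abelianGroup using (⁻¹-∙-comm)
  open Algebra.Properties.CommutativeSemigroup *-commutativeSemigroup using (interchange)
  open Algebra.Properties.Semiring.Mult semiring using (×-homo-+; ×1-homo-*) renaming (_×_ to _·_)
  open Relation.Binary.Reasoning.Setoid setoid

  ⟦_⟧ℤ : ℤ → Carrier
  ⟦ + n ⟧ℤ      = n · 1#
  ⟦ -[1+ n ] ⟧ℤ = - (suc n · 1#)

  ⟦_⟧± : Sign → Carrier
  ⟦ Sign.+ ⟧± = 1#
  ⟦ Sign.- ⟧± = - 1#

  ⟦◃⟧ : ∀ s n → ⟦ s ◃ n ⟧ℤ ≈ ⟦ s ⟧± * (n · 1#)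
  ⟦◃⟧ s       zero    = sym (zeroʳ _)
  ⟦◃⟧ Sign.+ (suc n) = sym (*-identityˡ _)
  ⟦◃⟧ Sign.- (suc n) = sym (-1*x≈-x _)

  ⟦sign*abs⟧ : ∀ i → ⟦ i ⟧ℤ ≈ ⟦ sign i ⟧± * (∣ i ∣ · 1#)
  ⟦sign*abs⟧ (+ n)    = sym (*-identityˡ _)
  ⟦sign*abs⟧ -[1+ n ] = sym (-1*x≈-x _)

  ⟦⟧±-homo-* : ∀ s t → ⟦ s Sign.* t ⟧± ≈ ⟦ s ⟧± * ⟦ t ⟧±
  ⟦⟧±-homo-* Sign.+ t      = sym (*-identityˡ _)
  ⟦⟧±-homo-* Sign.- Sign.+ = sym (*-identityʳ _)
  ⟦⟧±-homo-* Sign.- Sign.- = begin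
    1#               ≈⟨ -‿involutive 1# ⟨
    - - 1#           ≈⟨ -1*x≈-x (- 1#) ⟨
    - 1# * - 1#      ∎

  *-homo : ∀ i j → ⟦ i ℤ.* j ⟧ℤ ≈ ⟦ i ⟧ℤ * ⟦ j ⟧ℤ
  *-homo i j = begin
    ⟦ sign i Sign.* sign j ◃ ∣ i ∣ ℕ.* ∣ j ∣ ⟧ℤ
      ≈⟨ ⟦◃⟧ (sign i Sign.* sign j) (∣ i ∣ ℕ.* ∣ j ∣) ⟩
    ⟦ sign i Sign.* sign j ⟧± * ((∣ i ∣ ℕ.* ∣ j ∣) · 1#)
      ≈⟨ *-cong (⟦⟧±-homo-* (sign i) (sign j)) (×1-homo-* ∣ i ∣ ∣ j ∣) ⟩
    (⟦ sign i ⟧± * ⟦ sign j ⟧±) * ((∣ i ∣ · 1#) * (∣ j ∣ · 1#))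
      ≈⟨ interchange _ _ _ _ ⟩
    (⟦ sign i ⟧± * (∣ i ∣ · 1#)) * (⟦ sign j ⟧± * (∣ j ∣ · 1#))
      ≈⟨ *-cong (⟦sign*abs⟧ i) (⟦sign*abs⟧ j) ⟨
    ⟦ i ⟧ℤ * ⟦ j ⟧ℤ ∎

  1+x-[1+y]≈x-y : ∀ x y → (1# + x) - (1# + y) ≈ x - y
  1+x-[1+y]≈x-y x y = begin
    (1# + x) + - (1# + y)   ≈⟨ +-cong (+-comm 1# x) (sym (⁻¹-∙-comm 1# y)) ⟩
    (x + 1#) + (- 1# + - y) ≈⟨ +-assoc x 1# _ ⟩
    x + (1# + (- 1# + - y)) ≈⟨ +-congˡ (+-assoc 1# (- 1#) (- y)) ⟨
    x + ((1# - 1#) + - y)   ≈⟨ +-congˡ (+-congʳ (-‿inverseʳ 1#)) ⟩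
    x + (0# + - y)          ≈⟨ +-congˡ (+-identityˡ (- y)) ⟩
    x - y                   ∎

  ⊖-homo : ∀ m n → ⟦ m ⊖ n ⟧ℤ ≈ m · 1# - n · 1#
  ⊖-homo zero    zero    = sym (-‿inverseʳ 0#)
  ⊖-homo zero    (suc n) = sym (+-identityˡ _)
  ⊖-homo (suc m) zero    = sym (trans (+-congˡ -0#≈0#) (+-identityʳ _))
  ⊖-homo (suc m) (suc n) = begin
    ⟦ suc m ⊖ suc n ⟧ℤ ≡⟨ ≡.cong ⟦_⟧ℤ (ℤ.[1+m]⊖[1+n]≡m⊖n m n) ⟩
    ⟦ m ⊖ n ⟧ℤ          ≈⟨ ⊖-homo m n ⟩
    m · 1# - n · 1#     ≈⟨ 1+x-[1+y]≈x-y _ _ ⟨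
    suc m · 1# - suc n · 1# ∎

  +-homo : ∀ i j → ⟦ i ℤ.+ j ⟧ℤ ≈ ⟦ i ⟧ℤ + ⟦ j ⟧ℤ
  +-homo (+ m)    (+ n)    = ×-homo-+ 1# m n
  +-homo (+ m)    -[1+ n ] = ⊖-homo m (suc n)
  +-homo -[1+ m ] (+ n)    = trans (⊖-homo n (suc m)) (+-comm _ _)
  +-homo -[1+ m ] -[1+ n ] = begin
    - (suc (suc (m ℕ.+ n)) · 1#)      ≡⟨ ≡.cong (λ k → - (suc k · 1#)) (ℕ.+-suc m n) ⟨
    - ((suc m ℕ.+ suc n) · 1#)        ≈⟨ -‿cong (×-homo-+ 1# (suc m) (suc n)) ⟩
    - (suc m · 1# + suc n · 1#)       ≈⟨ ⁻¹-∙-comm _ _ ⟨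
    - (suc m · 1#) + - (suc n · 1#)   ∎

  -‿homo : ∀ i → ⟦ ℤ.- i ⟧ℤ ≈ - ⟦ i ⟧ℤ
  -‿homo (+ zero)    = sym -0#≈0#
  -‿homo (+ suc n)   = refl
  -‿homo -[1+ n ]    = sym (-‿involutive _)

  homomorphism : ℤ.+-*-rawRing -Raw-AlmostCommutative⟶ fromCommutativeRing R
  homomorphism = record
    { ⟦_⟧ = ⟦_⟧ℤ ; +-homo = +-homo ; *-homo = *-homo ; -‿homo = -‿homo
    ; 0-homo = refl ; 1-homo = +-identityʳ 1# }

  open Algebra.Solver.Ring ℤ.+-*-rawRing (fromCommutativeRing R) homomorphism
    (λ i j → map (λ i≡j → reflexive (≡.cong ⟦_⟧ℤ i≡j)) (dec⇒maybe (i ℤ.≟ j)))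
    public using (solve; _:+_; _:*_; :-_; _:=_)

module FiniteSums {c ℓ : Level} (R : CommutativeRing c ℓ) where
  open CommutativeRing R hiding (zero)
  open FPS R using (sumTo)
  open Algebra.Properties.AbelianGroup +-abelianGroup using (⁻¹-∙-comm)
  open Algebra.Properties.CommutativeSemigroup +-commutativeSemigroup using (interchange)

  sumTo-cong-< : ∀ n {f g : ℕ → Carrier} → (∀ i → i < n → f i ≈ g i) → sumTo n f ≈ sumTo n g
  sumTo-cong-< zero    f≈g = refl
  sumTo-cong-< (suc n) f≈g = +-cong (sumTo-cong-< n (λ i i<n → f≈g i (≤-trans i<n (n≤1+n n)))) (f≈g n ≤-refl)

  sumTo-cong : ∀ n {f g : ℕ → Carrier} → (∀ i → f i ≈ g i) → sumTo n f ≈ sumTo n g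
  sumTo-cong n f≈g = sumTo-cong-< n (λ i _ → f≈g i)

  sumTo-zero : ∀ n {f : ℕ → Carrier} → (∀ i → i < n → f i ≈ 0#) → sumTo n f ≈ 0#
  sumTo-zero zero    f≈0 = refl
  sumTo-zero (suc n) f≈0 =
    trans (+-cong (sumTo-zero n (λ i i<n → f≈0 i (≤-trans i<n (n≤1+n n)))) (f≈0 n ≤-refl)) (+-identityˡ 0#)

  sumTo-distrib-+ : ∀ n (f g : ℕ → Carrier) → sumTo n (λ i → f i + g i) ≈ sumTo n f + sumTo n g
  sumTo-distrib-+ zero    f g = sym (+-identityˡ 0#)
  sumTo-distrib-+ (suc n) f g = trans (+-congʳ (sumTo-distrib-+ n f g)) (interchange _ _ _ _)

  *-distribˡ-sumTo : ∀ n x (f : ℕ → Carrier) → x * sumTo n f ≈ sumTo n (λ i → x * f i)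
  *-distribˡ-sumTo zero    x f = zeroʳ x
  *-distribˡ-sumTo (suc n) x f = trans (distribˡ x _ _) (+-congʳ (*-distribˡ-sumTo n x f))

  -‿distrib-sumTo : ∀ n (f : ℕ → Carrier) → - sumTo n f ≈ sumTo n (λ i → - f i)
  -‿distrib-sumTo zero    f = trans (sym (+-identityˡ (- 0#))) (-‿inverseʳ 0#)
  -‿distrib-sumTo (suc n) f = trans (sym (⁻¹-∙-comm _ _)) (+-congʳ (-‿distrib-sumTo n f))

  sumTo-head : ∀ n (f : ℕ → Carrier) → sumTo (suc n) f ≈ f 0 + sumTo n (λ i → f (suc i))
  sumTo-head zero    f = trans (+-identityˡ _) (sym (+-identityʳ _))
  sumTo-head (suc n) f = trans (+-congʳ (sumTo-head n f)) (+-assoc _ _ _)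

  sumTo-reverse : ∀ n (f : ℕ → Carrier) → sumTo (suc n) f ≈ sumTo (suc n) (λ i → f (n ∸ i))
  sumTo-reverse zero    f = refl
  sumTo-reverse (suc n) f =
    trans (+-congʳ (sumTo-reverse n f)) (trans (+-comm _ _) (sym (sumTo-head (suc n) (λ i → f (suc n ∸ i)))))

  sumTo-vanishing-tail : ∀ {n} N (f : ℕ → Carrier) → n ≤ N → (∀ i → n ≤ i → f i ≈ 0#) → sumTo N f ≈ sumTo n f
  sumTo-vanishing-tail zero    f z≤n f≈0 = refl
  sumTo-vanishing-tail (suc N) f n≤1+N f≈0 with m≤n⇒m<n∨m≡n n≤1+N
  ... | inj₂ ≡.refl     = refl
  ... | inj₁ (s≤s n≤N) = trans (+-cong (sumTo-vanishing-tail N f n≤N f≈0) (f≈0 N n≤N)) (+-identityʳ _)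

module PowerSeriesRing {c ℓ : Level} (R : CommutativeRing c ℓ) where
  open CommutativeRing R hiding (zero)
  open FPS R
  open FiniteSums R
  open Relation.Binary.Reasoning.Setoid setoid

  zeroₛ : Series
  zeroₛ _ = 0#

  infix 8 -ₛ_
  -ₛ_ : Series → Series
  (-ₛ a) n = - a n

  tail : Series → Series
  tail a n = a (suc n)

  const : Carrier → Series
  const x zero    = x
  const x (suc n) = 0#

  infixr 7 _·ₛ_
  _·ₛ_ : Carrier → Series → Series
  (x ·ₛ a) n = x * a n

  ≈ₛ-refl : ∀ {a} → a ≈ₛ a
  ≈ₛ-refl _ = refl

  ≈ₛ-sym : ∀ {a b} → a ≈ₛ b → b ≈ₛ a
  ≈ₛ-sym a≈b n = sym (a≈b n)

  ≈ₛ-trans : ∀ {a b d} → a ≈ₛ b → b ≈ₛ d → a ≈ₛ d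
  ≈ₛ-trans a≈b b≈d n = trans (a≈b n) (b≈d n)

  *ₛ-head : ∀ a b → (a *ₛ b) 0 ≈ a 0 * b 0
  *ₛ-head a b = +-identityˡ _

  *ₛ-tail : ∀ a b → tail (a *ₛ b) ≈ₛ (a 0 ·ₛ tail b) +ₛ (tail a *ₛ b)
  *ₛ-tail a b n = sumTo-head (suc n) (λ i → a i * b (suc n ∸ i))

  *ₛ-cong : ∀ {a a′ b b′} → a ≈ₛ a′ → b ≈ₛ b′ → a *ₛ b ≈ₛ a′ *ₛ b′
  *ₛ-cong a≈a′ b≈b′ n = sumTo-cong (suc n) (λ i → *-cong (a≈a′ i) (b≈b′ (n ∸ i)))

  *ₛ-comm : ∀ a b → a *ₛ b ≈ₛ b *ₛ a
  *ₛ-comm a b n = trans (sumTo-reverse n _) (sumTo-cong-< (suc n) swap)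
    where
    swap : ∀ i → i < suc n → a (n ∸ i) * b (n ∸ (n ∸ i)) ≈ b i * a (n ∸ i)
    swap i (s≤s i≤n) = trans (*-comm _ _) (*-congʳ (reflexive (≡.cong b (m∸[m∸n]≡n i≤n))))

  *ₛ-distribˡ : ∀ a b d → a *ₛ (b +ₛ d) ≈ₛ (a *ₛ b) +ₛ (a *ₛ d)
  *ₛ-distribˡ a b d n = trans (sumTo-cong (suc n) (λ i → distribˡ _ _ _)) (sumTo-distrib-+ (suc n) _ _)

  *ₛ-distribʳ : ∀ a b d → (b +ₛ d) *ₛ a ≈ₛ (b *ₛ a) +ₛ (d *ₛ a)
  *ₛ-distribʳ a b d = ≈ₛ-trans (*ₛ-comm (b +ₛ d) a)
    (≈ₛ-trans (*ₛ-distribˡ a b d) (λ n → +-cong (*ₛ-comm a b n) (*ₛ-comm a d n)))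

  *ₛ-zeroˡ : ∀ a → zeroₛ *ₛ a ≈ₛ zeroₛ
  *ₛ-zeroˡ a n = sumTo-zero (suc n) (λ i _ → zeroˡ _)

  ·ₛ-*ₛ-assoc : ∀ x a b → (x ·ₛ a) *ₛ b ≈ₛ x ·ₛ (a *ₛ b)
  ·ₛ-*ₛ-assoc x a b n = trans (sumTo-cong (suc n) (λ i → *-assoc _ _ _)) (sym (*-distribˡ-sumTo (suc n) x _))

  *ₛ-identityˡ : ∀ a → oneₛ *ₛ a ≈ₛ a
  *ₛ-identityˡ a zero    = trans (*ₛ-head oneₛ a) (*-identityˡ _)
  *ₛ-identityˡ a (suc n) = begin
    (oneₛ *ₛ a) (suc n)                  ≈⟨ *ₛ-tail oneₛ a n ⟩
    1# * a (suc n) + (zeroₛ *ₛ a) n      ≈⟨ +-cong (*-identityˡ _) (*ₛ-zeroˡ a n) ⟩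
    a (suc n) + 0#                       ≈⟨ +-identityʳ _ ⟩
    a (suc n)                            ∎

  *ₛ-identityʳ : ∀ a → a *ₛ oneₛ ≈ₛ a
  *ₛ-identityʳ a = ≈ₛ-trans (*ₛ-comm a oneₛ) (*ₛ-identityˡ a)

  *ₛ-assoc : ∀ a b d → (a *ₛ b) *ₛ d ≈ₛ a *ₛ (b *ₛ d)
  *ₛ-assoc a b d zero = begin
    ((a *ₛ b) *ₛ d) 0    ≈⟨ trans (*ₛ-head (a *ₛ b) d) (*-congʳ (*ₛ-head a b)) ⟩
    (a 0 * b 0) * d 0    ≈⟨ *-assoc _ _ _ ⟩
    a 0 * (b 0 * d 0)    ≈⟨ sym (trans (*ₛ-head a (b *ₛ d)) (*-congˡ (*ₛ-head b d))) ⟩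
    (a *ₛ (b *ₛ d)) 0    ∎
  *ₛ-assoc a b d (suc n) = begin
    ((a *ₛ b) *ₛ d) (suc n)
      ≈⟨ *ₛ-tail (a *ₛ b) d n ⟩
    (a *ₛ b) 0 * d (suc n) + (tail (a *ₛ b) *ₛ d) n
      ≈⟨ +-cong (*-congʳ (*ₛ-head a b)) (*ₛ-cong {b = d} (*ₛ-tail a b) ≈ₛ-refl n) ⟩
    (a 0 * b 0) * d (suc n) + (((a 0 ·ₛ tail b) +ₛ (tail a *ₛ b)) *ₛ d) n
      ≈⟨ +-congˡ (*ₛ-distribʳ d _ _ n) ⟩
    (a 0 * b 0) * d (suc n) + (((a 0 ·ₛ tail b) *ₛ d) n + ((tail a *ₛ b) *ₛ d) n)
      ≈⟨ +-congˡ (+-cong (·ₛ-*ₛ-assoc (a 0) (tail b) d n) (*ₛ-assoc (tail a) b d n)) ⟩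
    (a 0 * b 0) * d (suc n) + (a 0 * (tail b *ₛ d) n + (tail a *ₛ (b *ₛ d)) n)
      ≈⟨ regroup _ _ _ _ _ ⟩
    a 0 * (b 0 * d (suc n) + (tail b *ₛ d) n) + (tail a *ₛ (b *ₛ d)) n
      ≈⟨ +-congʳ (*-congˡ (*ₛ-tail b d n)) ⟨
    a 0 * (b *ₛ d) (suc n) + (tail a *ₛ (b *ₛ d)) n
      ≈⟨ *ₛ-tail a (b *ₛ d) n ⟨
    (a *ₛ (b *ₛ d)) (suc n) ∎
    where
    open IntegerCoefficientSolver R
    regroup : ∀ x y z u v → (x * y) * z + (x * u + v) ≈ x * (y * z + u) + v
    regroup = solve 5 (λ x y z u v → (x :* y) :* z :+ (x :* u :+ v) := x :* (y :* z :+ u) :+ v) refl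

  seriesRing : CommutativeRing c ℓ
  seriesRing = record
    { Carrier = Series ; _≈_ = _≈ₛ_ ; _+_ = _+ₛ_ ; _*_ = _*ₛ_ ; -_ = -ₛ_ ; 0# = zeroₛ ; 1# = oneₛ
    ; isCommutativeRing = record
      { isRing = record
        { +-isAbelianGroup = Pointwise.isAbelianGroup ℕ +-isAbelianGroup
        ; *-cong           = *ₛ-cong
        ; *-assoc          = *ₛ-assoc
        ; *-identity       = *ₛ-identityˡ , *ₛ-identityʳ
        ; distrib          = *ₛ-distribˡ , *ₛ-distribʳ
        }
      ; *-comm = *ₛ-comm
      }
    }

  module Sₛ = CommutativeRing seriesRing

module Composition {c ℓ : Level} (R : CommutativeRing c ℓ) where
  open CommutativeRing R hiding (zero)
  open FPS R
  open FiniteSums R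
  open PowerSeriesRing R
  open Relation.Binary.Reasoning.Setoid setoid
  module Σₛ = FiniteSums seriesRing

  powₛ-cong : ∀ {u w} → u ≈ₛ w → ∀ k → powₛ u k ≈ₛ powₛ w k
  powₛ-cong u≈w zero    = ≈ₛ-refl
  powₛ-cong u≈w (suc k) = *ₛ-cong u≈w (powₛ-cong u≈w k)

  ∘ₛ-congˡ : ∀ {a b} u → a ≈ₛ b → a ∘ₛ u ≈ₛ b ∘ₛ u
  ∘ₛ-congˡ u a≈b n = sumTo-cong (suc n) (λ k → *-congʳ (a≈b k))

  ∘ₛ-congʳ : ∀ a {u w} → u ≈ₛ w → a ∘ₛ u ≈ₛ a ∘ₛ w
  ∘ₛ-congʳ a u≈w n = sumTo-cong (suc n) (λ k → *-congˡ (powₛ-cong u≈w k n))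

  ∘ₛ-head : ∀ a u → (a ∘ₛ u) 0 ≈ a 0
  ∘ₛ-head a u = trans (+-identityˡ _) (*-identityʳ _)

  ∘ₛ-coeff₁ : ∀ a u → (a ∘ₛ u) 1 ≈ a 1 * u 1
  ∘ₛ-coeff₁ a u = trans (+-cong (trans (+-identityˡ _) (zeroʳ _)) (*-congˡ (*ₛ-identityʳ u 1))) (+-identityˡ _)

  ∘ₛ-+ₛ : ∀ a b u → (a +ₛ b) ∘ₛ u ≈ₛ (a ∘ₛ u) +ₛ (b ∘ₛ u)
  ∘ₛ-+ₛ a b u n = trans (sumTo-cong (suc n) (λ k → distribʳ _ _ _)) (sumTo-distrib-+ (suc n) _ _)

  ∘ₛ--ₛ : ∀ a u → (-ₛ a) ∘ₛ u ≈ₛ -ₛ (a ∘ₛ u)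
  ∘ₛ--ₛ a u n = trans (sumTo-cong (suc n) (λ k → sym (-‿distribˡ-* _ _))) (sym (-‿distrib-sumTo (suc n) _))
    where open Algebra.Properties.Ring ring using (-‿distribˡ-*)

  ∘ₛ-·ₛ : ∀ x a u → (x ·ₛ a) ∘ₛ u ≈ₛ x ·ₛ (a ∘ₛ u)
  ∘ₛ-·ₛ x a u n = trans (sumTo-cong (suc n) (λ k → *-assoc _ _ _)) (sym (*-distribˡ-sumTo (suc n) x _))

  const-*ₛ : ∀ x a → const x *ₛ a ≈ₛ x ·ₛ a
  const-*ₛ x a zero    = *ₛ-head (const x) a
  const-*ₛ x a (suc n) = trans (*ₛ-tail (const x) a n) (trans (+-congˡ (*ₛ-zeroˡ a n)) (+-identityʳ _))

  oneₛ≈const1 : oneₛ ≈ₛ const 1#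
  oneₛ≈const1 zero    = refl
  oneₛ≈const1 (suc n) = refl

  tail-X : tail X ≈ₛ oneₛ
  tail-X zero    = refl
  tail-X (suc m) = refl

  X-*ₛ : ∀ a → X *ₛ a ≈ₛ xTimes a
  X-*ₛ a zero    = trans (*ₛ-head X a) (zeroˡ _)
  X-*ₛ a (suc n) = begin
    (X *ₛ a) (suc n)                   ≈⟨ *ₛ-tail X a n ⟩
    0# * a (suc n) + (tail X *ₛ a) n   ≈⟨ +-cong (zeroˡ _) (*ₛ-cong {b = a} tail-X ≈ₛ-refl n) ⟩
    0# + (oneₛ *ₛ a) n                 ≈⟨ +-identityˡ _ ⟩
    (oneₛ *ₛ a) n                      ≈⟨ *ₛ-identityˡ a n ⟩
    a n                                ∎

  sumTo-coeff : ∀ N (F : ℕ → Series) n → FPS.sumTo seriesRing N F n ≈ sumTo N (λ k → F k n)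
  sumTo-coeff zero    F n = refl
  sumTo-coeff (suc N) F n = +-congʳ (sumTo-coeff N F n)

  module Substitution (u : Series) (u₀≈0 : u 0 ≈ 0#) where

    u₀*x≈0 : ∀ x → u 0 * x ≈ 0#
    u₀*x≈0 x = trans (*-congʳ u₀≈0) (zeroˡ x)

    powₛ-low : ∀ k n → n < k → powₛ u k n ≈ 0#
    powₛ-low (suc k) zero    _         = trans (*ₛ-head u (powₛ u k)) (u₀*x≈0 _)
    powₛ-low (suc k) (suc n) (s≤s n<k) = trans (*ₛ-tail u (powₛ u k) n)
      (trans (+-cong (u₀*x≈0 _) (sumTo-zero (suc n) λ i _ →
        trans (*-congˡ (powₛ-low k (n ∸ i) (≤-trans (s≤s (m∸n≤m n i)) n<k))) (zeroʳ _)))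
      (+-identityˡ 0#))

    *ₛ-coeff-local : ∀ {a b} n → (∀ j → j < n → a j ≈ b j) → (u *ₛ a) n ≈ (u *ₛ b) n
    *ₛ-coeff-local {a} {b} zero    _   =
      trans (*ₛ-head u a) (trans (u₀*x≈0 _) (sym (trans (*ₛ-head u b) (u₀*x≈0 _))))
    *ₛ-coeff-local {a} {b} (suc n) a≈b = begin
      (u *ₛ a) (suc n)                       ≈⟨ *ₛ-tail u a n ⟩
      u 0 * a (suc n) + (tail u *ₛ a) n      ≈⟨ +-cong (trans (u₀*x≈0 _) (sym (u₀*x≈0 _)))
                                                   (sumTo-cong (suc n) λ i → *-congˡ (a≈b (n ∸ i) (s≤s (m∸n≤m n i)))) ⟩
      u 0 * b (suc n) + (tail u *ₛ b) n      ≈⟨ *ₛ-tail u b n ⟨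
      (u *ₛ b) (suc n)                       ∎

    partialSum : ℕ → Series → Series
    partialSum N a = FPS.sumTo seriesRing N (λ k → a k ·ₛ powₛ u k)

    partialSum-coeff : ∀ a {N n} → n < N → partialSum N a n ≈ (a ∘ₛ u) n
    partialSum-coeff a {N} {n} n<N = trans (sumTo-coeff N _ n)
      (sumTo-vanishing-tail N _ n<N (λ k n<k → trans (*-congˡ (powₛ-low k n n<k)) (zeroʳ _)))

    partialSum-suc : ∀ N a → partialSum (suc N) a ≈ₛ const (a 0) +ₛ (u *ₛ partialSum N (tail a))
    partialSum-suc N a = ≈ₛ-trans (Σₛ.sumTo-head N _) (λ n → +-cong (head≈ n) (tail≈ n))
      where
      head≈ : a 0 ·ₛ oneₛ ≈ₛ const (a 0)
      head≈ zero    = *-identityʳ _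
      head≈ (suc n) = zeroʳ _
      tail≈ : FPS.sumTo seriesRing N (λ k → a (suc k) ·ₛ (u *ₛ powₛ u k)) ≈ₛ u *ₛ partialSum N (tail a)
      tail≈ = ≈ₛ-trans (Σₛ.sumTo-cong N λ k → scalar-past-u (a (suc k)) (powₛ u k))
                        (≈ₛ-sym (Σₛ.*-distribˡ-sumTo N u _))
        where
        scalar-past-u : ∀ x p → x ·ₛ (u *ₛ p) ≈ₛ u *ₛ (x ·ₛ p)
        scalar-past-u x p = ≈ₛ-trans (λ n → *-congˡ (*ₛ-comm u p n))
          (≈ₛ-trans (≈ₛ-sym (·ₛ-*ₛ-assoc x p u)) (*ₛ-comm (x ·ₛ p) u))

    -- Together with *ₛ-coeff-local this recursion drives every proof about substitution below,
    -- by strong induction on the coefficient index.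
    ∘ₛ-unfold : ∀ a → a ∘ₛ u ≈ₛ const (a 0) +ₛ (u *ₛ (tail a ∘ₛ u))
    ∘ₛ-unfold a n = begin
      (a ∘ₛ u) n                                        ≈⟨ partialSum-coeff a ≤-refl ⟨
      partialSum (suc n) a n                            ≈⟨ partialSum-suc n a n ⟩
      const (a 0) n + (u *ₛ partialSum n (tail a)) n    ≈⟨ +-congˡ (*ₛ-coeff-local n λ j → partialSum-coeff (tail a)) ⟩
      const (a 0) n + (u *ₛ (tail a ∘ₛ u)) n            ∎

    ∘ₛ-const : ∀ x → const x ∘ₛ u ≈ₛ const x
    ∘ₛ-const x n = trans (∘ₛ-unfold (const x) n)
      (trans (+-congˡ (trans (*ₛ-cong {a = u} ≈ₛ-refl tail-const∘u n) (*ₛ-zeroʳ n))) (+-identityʳ _))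
      where
      tail-const∘u : tail (const x) ∘ₛ u ≈ₛ zeroₛ
      tail-const∘u m = sumTo-zero (suc m) (λ i _ → zeroˡ _)
      *ₛ-zeroʳ : u *ₛ zeroₛ ≈ₛ zeroₛ
      *ₛ-zeroʳ = ≈ₛ-trans (*ₛ-comm u zeroₛ) (*ₛ-zeroˡ u)

    ∘ₛ-one : oneₛ ∘ₛ u ≈ₛ oneₛ
    ∘ₛ-one = ≈ₛ-trans (∘ₛ-congˡ u oneₛ≈const1) (≈ₛ-trans (∘ₛ-const 1#) (≈ₛ-sym oneₛ≈const1))

    ∘ₛ-X : X ∘ₛ u ≈ₛ u
    ∘ₛ-X n = trans (∘ₛ-unfold X n) (trans (+-cong (const0 n)
      (trans (*ₛ-cong {a = u} ≈ₛ-refl (≈ₛ-trans (∘ₛ-congˡ u tail-X) ∘ₛ-one) n) (*ₛ-identityʳ u n)))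
      (+-identityˡ _))
      where
      const0 : const 0# ≈ₛ zeroₛ
      const0 zero    = refl
      const0 (suc m) = refl

    ∘ₛ-*ₛ : ∀ a b → (a *ₛ b) ∘ₛ u ≈ₛ (a ∘ₛ u) *ₛ (b ∘ₛ u)
    ∘ₛ-*ₛ a b n = <-rec P step n a b
      where
      P : ℕ → Set (c ⊔ ℓ)
      P n = ∀ a b → ((a *ₛ b) ∘ₛ u) n ≈ ((a ∘ₛ u) *ₛ (b ∘ₛ u)) n
      step : ∀ n → (∀ {j} → j < n → P j) → P n
      step n IH a b = begin
        ((a *ₛ b) ∘ₛ u) n
          ≈⟨ ∘ₛ-unfold (a *ₛ b) n ⟩
        const ((a *ₛ b) 0) n + (u *ₛ (tail (a *ₛ b) ∘ₛ u)) n
          ≈⟨ +-cong (head≈ n) (*ₛ-coeff-local n tail≈) ⟩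
        ((ca *ₛ cb) +ₛ (u *ₛ ((ca *ₛ B′) +ₛ (A′ *ₛ (b ∘ₛ u))))) n
          ≈⟨ +-congˡ (*ₛ-cong {a = u} ≈ₛ-refl unfold-b n) ⟩
        ((ca *ₛ cb) +ₛ (u *ₛ ((ca *ₛ B′) +ₛ (A′ *ₛ (cb +ₛ (u *ₛ B′)))))) n
          ≈⟨ expand ca cb u A′ B′ n ⟩
        ((ca +ₛ (u *ₛ A′)) *ₛ (cb +ₛ (u *ₛ B′))) n
          ≈⟨ *ₛ-cong (∘ₛ-unfold a) (∘ₛ-unfold b) n ⟨
        ((a ∘ₛ u) *ₛ (b ∘ₛ u)) n ∎
        where
        ca cb A′ B′ : Series
        ca = const (a 0)
        cb = const (b 0)
        A′ = tail a ∘ₛ u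
        B′ = tail b ∘ₛ u
        head≈ : const ((a *ₛ b) 0) ≈ₛ ca *ₛ cb
        head≈ zero    = trans (*ₛ-head a b) (sym (*ₛ-head ca cb))
        head≈ (suc m) = sym (trans (const-*ₛ (a 0) cb (suc m)) (zeroʳ _))
        tail≈ : ∀ j → j < n → (tail (a *ₛ b) ∘ₛ u) j ≈ ((ca *ₛ B′) +ₛ (A′ *ₛ (b ∘ₛ u))) j
        tail≈ j j<n = begin
          (tail (a *ₛ b) ∘ₛ u) j                              ≈⟨ ∘ₛ-congˡ u (*ₛ-tail a b) j ⟩
          (((a 0 ·ₛ tail b) +ₛ (tail a *ₛ b)) ∘ₛ u) j           ≈⟨ ∘ₛ-+ₛ _ _ u j ⟩
          ((a 0 ·ₛ tail b) ∘ₛ u) j + ((tail a *ₛ b) ∘ₛ u) j    ≈⟨ +-cong (∘ₛ-·ₛ (a 0) (tail b) u j) (IH j<n (tail a) b) ⟩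
          (a 0 ·ₛ B′) j + (A′ *ₛ (b ∘ₛ u)) j                   ≈⟨ +-congʳ (const-*ₛ (a 0) B′ j) ⟨
          ((ca *ₛ B′) +ₛ (A′ *ₛ (b ∘ₛ u))) j                        ∎
        unfold-b : ((ca *ₛ B′) +ₛ (A′ *ₛ (b ∘ₛ u))) ≈ₛ ((ca *ₛ B′) +ₛ (A′ *ₛ (cb +ₛ (u *ₛ B′))))
        unfold-b m = +-congˡ (*ₛ-cong {a = A′} ≈ₛ-refl (∘ₛ-unfold b) m)
        expand : ∀ ca cb U A B → (ca *ₛ cb) +ₛ (U *ₛ ((ca *ₛ B) +ₛ (A *ₛ (cb +ₛ (U *ₛ B)))))
                                 ≈ₛ (ca +ₛ (U *ₛ A)) *ₛ (cb +ₛ (U *ₛ B))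
        expand = solve 5 (λ ca cb U A B → ca :* cb :+ U :* (ca :* B :+ A :* (cb :+ U :* B))
                                          := (ca :+ U :* A) :* (cb :+ U :* B)) ≈ₛ-refl
          where open IntegerCoefficientSolver seriesRing

    ∘ₛ-powₛ : ∀ a k → powₛ a k ∘ₛ u ≈ₛ powₛ (a ∘ₛ u) k
    ∘ₛ-powₛ a zero    = ∘ₛ-one
    ∘ₛ-powₛ a (suc k) = ≈ₛ-trans (∘ₛ-*ₛ a (powₛ a k)) (*ₛ-cong {a = a ∘ₛ u} ≈ₛ-refl (∘ₛ-powₛ a k))

    xTimes-∘ₛ : ∀ a → xTimes a ∘ₛ u ≈ₛ u *ₛ (a ∘ₛ u)
    xTimes-∘ₛ a = ≈ₛ-trans (∘ₛ-congˡ u (≈ₛ-sym (X-*ₛ a)))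
      (≈ₛ-trans (∘ₛ-*ₛ X a) (*ₛ-cong ∘ₛ-X (≈ₛ-refl {a ∘ₛ u})))

  ∘ₛ-assoc : ∀ {u w} → u 0 ≈ 0# → w 0 ≈ 0# → ∀ a → (a ∘ₛ u) ∘ₛ w ≈ₛ a ∘ₛ (u ∘ₛ w)
  ∘ₛ-assoc {u} {w} u₀≈0 w₀≈0 a n = <-rec P step n a
    where
    module U  = Substitution u u₀≈0
    module W  = Substitution w w₀≈0
    module UW = Substitution (u ∘ₛ w) (trans (∘ₛ-head u w) u₀≈0)
    P : ℕ → Set (c ⊔ ℓ)
    P n = ∀ a → ((a ∘ₛ u) ∘ₛ w) n ≈ (a ∘ₛ (u ∘ₛ w)) n
    step : ∀ n → (∀ {j} → j < n → P j) → P n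
    step n IH a = begin
      ((a ∘ₛ u) ∘ₛ w) n                                       ≈⟨ ∘ₛ-congˡ w (U.∘ₛ-unfold a) n ⟩
      ((const (a 0) +ₛ (u *ₛ (tail a ∘ₛ u))) ∘ₛ w) n          ≈⟨ ∘ₛ-+ₛ _ _ w n ⟩
      (const (a 0) ∘ₛ w) n + ((u *ₛ (tail a ∘ₛ u)) ∘ₛ w) n   ≈⟨ +-cong (W.∘ₛ-const (a 0) n) (W.∘ₛ-*ₛ u _ n) ⟩
      const (a 0) n + ((u ∘ₛ w) *ₛ ((tail a ∘ₛ u) ∘ₛ w)) n   ≈⟨ +-congˡ (UW.*ₛ-coeff-local n λ j j<n → IH j<n (tail a)) ⟩
      const (a 0) n + ((u ∘ₛ w) *ₛ (tail a ∘ₛ (u ∘ₛ w))) n   ≈⟨ UW.∘ₛ-unfold a n ⟨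
      (a ∘ₛ (u ∘ₛ w)) n                                       ∎

  riordan-∘ₛ : ∀ {u} v → u 0 ≈ 0# → riordan (v ∘ₛ u) ≈ₘ (riordan u ·ₘ riordan v)
  riordan-∘ₛ {u} v u₀≈0 n k = begin
    powₛ (v ∘ₛ u) k n                           ≈⟨ Substitution.∘ₛ-powₛ u u₀≈0 v k n ⟨
    (powₛ v k ∘ₛ u) n                           ≈⟨ sumTo-cong (suc n) (λ j → *-comm _ _) ⟩
    (riordan u ·ₘ riordan v) n k                ∎

module NegatedArgument {c ℓ : Level} (R : CommutativeRing c ℓ) where
  open CommutativeRing R hiding (zero)
  open FPS R
  open PowerSeriesRing R
  open Composition R
  open Algebra.Properties.Ring ring using (-‿distribˡ-*; -‿involutive; -0#≈0#)
  open Relation.Binary.Reasoning.Setoid setoid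

  altSign : ℕ → Carrier
  altSign zero    = 1#
  altSign (suc n) = - altSign n

  altSign-even : ∀ m → altSign (2 *ℕ m) ≈ 1#
  altSign-even zero = refl
  altSign-even (suc m) = trans (reflexive (≡.cong altSign (*-suc 2 m))) (trans (-‿involutive _) (altSign-even m))

  negArg-coeff : ∀ a n → negArg a n ≈ altSign n * a n
  negArg-coeff a zero          = sym (*-identityˡ _)
  negArg-coeff a (suc zero)    = trans (-‿cong (sym (*-identityˡ _))) (-‿distribˡ-* _ _)
  negArg-coeff a (suc (suc n)) = trans (negArg-coeff (λ m → a (suc (suc m))) n) (*-congʳ (sym (-‿involutive _)))

  ∘ₛ-negX-coeff : ∀ a n → (a ∘ₛ (-ₛ X)) n ≈ altSign n * a n
  ∘ₛ-negX-coeff a zero    = trans (∘ₛ-head a (-ₛ X)) (sym (*-identityˡ _))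
  ∘ₛ-negX-coeff a (suc n) = begin
    (a ∘ₛ (-ₛ X)) (suc n)                            ≈⟨ ∘ₛ-unfold a (suc n) ⟩
    0# + ((-ₛ X) *ₛ (tail a ∘ₛ (-ₛ X))) (suc n)     ≈⟨ +-identityˡ _ ⟩
    ((-ₛ X) *ₛ (tail a ∘ₛ (-ₛ X))) (suc n)          ≈⟨ -X*ₛ (tail a ∘ₛ (-ₛ X)) (suc n) ⟩
    - (tail a ∘ₛ (-ₛ X)) n                          ≈⟨ -‿cong (∘ₛ-negX-coeff (tail a) n) ⟩
    - (altSign n * a (suc n))                       ≈⟨ -‿distribˡ-* _ _ ⟩
    altSign (suc n) * a (suc n)                     ∎
    where
    open Substitution (-ₛ X) -0#≈0#
    open Algebra.Properties.Ring Sₛ.ring using () renaming (-‿distribˡ-* to -‿distribˡ-*ₛ)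
    -X*ₛ : ∀ b → (-ₛ X) *ₛ b ≈ₛ -ₛ xTimes b
    -X*ₛ b = ≈ₛ-trans (≈ₛ-sym (-‿distribˡ-*ₛ X b)) (λ m → -‿cong (X-*ₛ b m))

  negArg≈∘ₛ-negX : ∀ a → negArg a ≈ₛ a ∘ₛ (-ₛ X)
  negArg≈∘ₛ-negX a n = trans (negArg-coeff a n) (sym (∘ₛ-negX-coeff a n))

  negX-∘ₛ : ∀ w → w 0 ≈ 0# → (-ₛ X) ∘ₛ w ≈ₛ -ₛ w
  negX-∘ₛ w w₀≈0 = ≈ₛ-trans (∘ₛ--ₛ X w) (λ n → -‿cong (Substitution.∘ₛ-X w w₀≈0 n))

  negArg-xTimes : ∀ a → negArg (xTimes a) ≈ₛ -ₛ xTimes (negArg a)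
  negArg-xTimes a zero    = sym -0#≈0#
  negArg-xTimes a (suc n) = begin
    negArg (xTimes a) (suc n)  ≈⟨ negArg-coeff (xTimes a) (suc n) ⟩
    - altSign n * a n          ≈⟨ -‿distribˡ-* _ _ ⟨
    - (altSign n * a n)        ≈⟨ -‿cong (negArg-coeff a n) ⟨
    - negArg a n               ∎

module Cancellation {c ℓ : Level} (R : CommutativeRing c ℓ) where
  open CommutativeRing R hiding (zero)
  open FPS R
  open PowerSeriesRing R
  open Composition R

  xTimes-injective : ∀ {a b} → xTimes a ≈ₛ xTimes b → a ≈ₛ b
  xTimes-injective xa≈xb n = xa≈xb (suc n)

  xTimes-tail : ∀ {a} → a 0 ≈ 0# → a ≈ₛ xTimes (tail a)
  xTimes-tail a₀≈0 zero    = a₀≈0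
  xTimes-tail a₀≈0 (suc n) = refl

  xTimes-zeroₛ : xTimes zeroₛ ≈ₛ zeroₛ
  xTimes-zeroₛ zero    = refl
  xTimes-zeroₛ (suc n) = refl

  xTimes-*ₛ : ∀ a b → xTimes a *ₛ b ≈ₛ xTimes (a *ₛ b)
  xTimes-*ₛ a b = ≈ₛ-trans (*ₛ-cong (≈ₛ-sym (X-*ₛ a)) (≈ₛ-refl {b}))
    (≈ₛ-trans (*ₛ-assoc X a b) (X-*ₛ (a *ₛ b)))

  xTimes-*ₛ≈0⇒*ₛ≈0 : ∀ a b → xTimes a *ₛ b ≈ₛ zeroₛ → a *ₛ b ≈ₛ zeroₛ
  xTimes-*ₛ≈0⇒*ₛ≈0 a b xab≈0 =
    xTimes-injective (≈ₛ-trans (≈ₛ-sym (xTimes-*ₛ a b)) (≈ₛ-trans xab≈0 (≈ₛ-sym xTimes-zeroₛ)))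

  unit-*ₛ≈0⇒≈0 : ∀ {v y} → v 0 * y ≈ 1# → ∀ d → v *ₛ d ≈ₛ zeroₛ → d ≈ₛ zeroₛ
  unit-*ₛ≈0⇒≈0 {v} {y} v₀y≈1 d vd≈0 zero = begin
    d 0                 ≈⟨ *-identityˡ _ ⟨
    1# * d 0            ≈⟨ *-congʳ (trans (*-comm y _) v₀y≈1) ⟨
    (y * v 0) * d 0     ≈⟨ *-assoc _ _ _ ⟩
    y * (v 0 * d 0)     ≈⟨ *-congˡ (trans (sym (*ₛ-head v d)) (vd≈0 0)) ⟩
    y * 0#              ≈⟨ zeroʳ y ⟩
    0#                  ∎
    where open Relation.Binary.Reasoning.Setoid setoid
  unit-*ₛ≈0⇒≈0 {v} v₀y≈1 d vd≈0 (suc n) = unit-*ₛ≈0⇒≈0 v₀y≈1 (tail d) v*tail-d≈0 n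
    where
    v*tail-d≈0 : v *ₛ tail d ≈ₛ zeroₛ
    v*tail-d≈0 = ≈ₛ-trans (*ₛ-comm v (tail d)) (xTimes-*ₛ≈0⇒*ₛ≈0 (tail d) v
      (≈ₛ-trans (*ₛ-cong (≈ₛ-sym (xTimes-tail (unit-*ₛ≈0⇒≈0 v₀y≈1 d vd≈0 0))) (≈ₛ-refl {v}))
      (≈ₛ-trans (*ₛ-comm d v) vd≈0)))

  order₁-*ₛ≈0⇒≈0 : ∀ {w y} → w 0 ≈ 0# → w 1 * y ≈ 1# → ∀ d → w *ₛ d ≈ₛ zeroₛ → d ≈ₛ zeroₛ
  order₁-*ₛ≈0⇒≈0 {w} w₀≈0 w₁y≈1 d wd≈0 = unit-*ₛ≈0⇒≈0 w₁y≈1 d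
    (xTimes-*ₛ≈0⇒*ₛ≈0 (tail w) d (≈ₛ-trans (*ₛ-cong (≈ₛ-sym (xTimes-tail w₀≈0)) (≈ₛ-refl {d})) wd≈0))

  square-root-unique : ∀ {a b y} → a *ₛ a ≈ₛ b *ₛ b → (a +ₛ b) 0 ≈ 0# → (a +ₛ b) 1 * y ≈ 1# → a ≈ₛ b
  square-root-unique {a} {b} a²≈b² [a+b]₀≈0 [a+b]₁y≈1 = x∙y⁻¹≈ε⇒x≈y a b
    (order₁-*ₛ≈0⇒≈0 [a+b]₀≈0 [a+b]₁y≈1 (a +ₛ (-ₛ b))
      (≈ₛ-trans (difference-of-squares a b) (x≈y⇒x∙y⁻¹≈ε a²≈b²)))
    where
    open Algebra.Properties.Group Sₛ.+-group using (x∙y⁻¹≈ε⇒x≈y; x≈y⇒x∙y⁻¹≈ε)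
    open IntegerCoefficientSolver seriesRing
    difference-of-squares : ∀ a b → (a +ₛ b) *ₛ (a +ₛ (-ₛ b)) ≈ₛ (a *ₛ a) +ₛ (-ₛ (b *ₛ b))
    difference-of-squares = solve 2 (λ a b → (a :+ b) :* (a :+ :- b) := a :* a :+ :- (b :* b)) ≈ₛ-refl

  module _ {u : Series} {y : Carrier} (u₀≈0 : u 0 ≈ 0#) (u₁y≈1 : u 1 * y ≈ 1#) where
    open Substitution u u₀≈0

    ∘ₛ≈0⇒≈0 : ∀ a → a ∘ₛ u ≈ₛ zeroₛ → a ≈ₛ zeroₛ
    ∘ₛ≈0⇒≈0 a a∘u≈0 zero    = trans (sym (∘ₛ-head a u)) (a∘u≈0 0)
    ∘ₛ≈0⇒≈0 a a∘u≈0 (suc n) =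
      ∘ₛ≈0⇒≈0 (tail a) (order₁-*ₛ≈0⇒≈0 u₀≈0 u₁y≈1 (tail a ∘ₛ u) u*[tail-a∘u]≈0) n
      where
      u*[tail-a∘u]≈0 : u *ₛ (tail a ∘ₛ u) ≈ₛ zeroₛ
      u*[tail-a∘u]≈0 m = begin
        (u *ₛ (tail a ∘ₛ u)) m                   ≈⟨ +-identityˡ _ ⟨
        0# + (u *ₛ (tail a ∘ₛ u)) m              ≈⟨ +-congʳ (const≈0 m) ⟨
        const (a 0) m + (u *ₛ (tail a ∘ₛ u)) m   ≈⟨ ∘ₛ-unfold a m ⟨
        (a ∘ₛ u) m                               ≈⟨ a∘u≈0 m ⟩
        0#                                       ∎
        where
        open Relation.Binary.Reasoning.Setoid setoid
        const≈0 : const (a 0) ≈ₛ zeroₛ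
        const≈0 zero    = ∘ₛ≈0⇒≈0 a a∘u≈0 0
        const≈0 (suc k) = refl

    ∘ₛ-injective : ∀ a b → a ∘ₛ u ≈ₛ b ∘ₛ u → a ≈ₛ b
    ∘ₛ-injective a b a∘u≈b∘u = x∙y⁻¹≈ε⇒x≈y a b (∘ₛ≈0⇒≈0 (a +ₛ (-ₛ b))
      (≈ₛ-trans (∘ₛ-+ₛ a (-ₛ b) u) (λ m → trans (+-congˡ (∘ₛ--ₛ b u m)) (x≈y⇒x∙y⁻¹≈ε a∘u≈b∘u m))))
      where open Algebra.Properties.Group Sₛ.+-group using (x∙y⁻¹≈ε⇒x≈y; x≈y⇒x∙y⁻¹≈ε)

module PseudoInvolution {c ℓ : Level} (R : CommutativeRing c ℓ) where
  open CommutativeRing R hiding (zero)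
  open FPS R
  open PowerSeriesRing R
  open Composition R
  open NegatedArgument R
  open Cancellation R

  two-invertible : IsFieldChar0 R → ∃ λ half → (1# + 1#) * half ≈ 1#
  two-invertible F with IsFieldChar0.inverse F (natCast R 2) (IsFieldChar0.char0 F 1)
  ... | half , 2*half≈1 = half , trans (*-congʳ (+-congˡ (sym (+-identityʳ 1#)))) 2*half≈1

  xh∘ₛxr≈xg : ∀ {g r h} → r *ₛ r ≈ₛ g → h ∘ₛ xTimes r ≈ₛ r → xTimes h ∘ₛ xTimes r ≈ₛ xTimes g
  xh∘ₛxr≈xg {g} {r} {h} r²≈g h∘xr≈r =
    ≈ₛ-trans (Substitution.xTimes-∘ₛ (xTimes r) refl h)
    (≈ₛ-trans (*ₛ-cong (≈ₛ-refl {xTimes r}) h∘xr≈r)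
    (≈ₛ-trans (xTimes-*ₛ r r) (λ { zero → refl ; (suc n) → r²≈g n })))

  riordan-factorisation : ∀ {g r h} → r *ₛ r ≈ₛ g → h ∘ₛ xTimes r ≈ₛ r →
    riordan (xTimes g) ≈ₘ (riordan (xTimes r) ·ₘ riordan (xTimes h))
  riordan-factorisation {g} {r} {h} r²≈g h∘xr≈r n k =
    trans (powₛ-cong (≈ₛ-sym (xh∘ₛxr≈xg r²≈g h∘xr≈r)) k n) (riordan-∘ₛ (xTimes h) refl n k)

  module Reciprocal {half : Carrier} (2*half≈1 : (1# + 1#) * half ≈ 1#)
    {g : Series} (g₀≈1 : g 0 ≈ 1#) (left-inverse : xTimes (negArg g) ∘ₛ xTimes g ≈ₛ X)
    {r : Series} (r₀≈1 : r 0 ≈ 1#) (r²≈g : r *ₛ r ≈ₛ g)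
    {h : Series} (h∘xr≈r : h ∘ₛ xTimes r ≈ₛ r) where

    open Algebra.Properties.Ring ring using (-0#≈0#)
    open Algebra.Properties.Ring Sₛ.ring using ()
      renaming (-‿distribˡ-* to -ₛ‿distribˡ-*ₛ; -‿involutive to -ₛ‿involutive)
    open Algebra.Properties.Group Sₛ.+-group using (⁻¹-injective)

    f u v : Series
    f = xTimes g
    u = xTimes r
    v = xTimes h

    f∘ₛ-f≈-X : f ∘ₛ (-ₛ f) ≈ₛ -ₛ X
    f∘ₛ-f≈-X = ⁻¹-injective (begin
      -ₛ (f ∘ₛ (-ₛ f))               ≈⟨ Sₛ.-‿cong (∘ₛ-congʳ f (negX-∘ₛ f refl)) ⟨
      -ₛ (f ∘ₛ ((-ₛ X) ∘ₛ f))        ≈⟨ Sₛ.-‿cong (∘ₛ-assoc -0#≈0# refl f) ⟨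
      -ₛ ((f ∘ₛ (-ₛ X)) ∘ₛ f)        ≈⟨ ∘ₛ--ₛ (f ∘ₛ (-ₛ X)) f ⟨
      (-ₛ (f ∘ₛ (-ₛ X))) ∘ₛ f        ≈⟨ ∘ₛ-congˡ f f̄≈-[f∘-X] ⟨
      xTimes (negArg g) ∘ₛ f         ≈⟨ left-inverse ⟩
      X                              ≈⟨ -ₛ‿involutive X ⟨
      -ₛ (-ₛ X)                      ∎)
      where
      open Relation.Binary.Reasoning.Setoid Sₛ.setoid
      f̄≈-[f∘-X] : xTimes (negArg g) ≈ₛ -ₛ (f ∘ₛ (-ₛ X))
      f̄≈-[f∘-X] = ≈ₛ-trans (≈ₛ-sym (-ₛ‿involutive _))
        (Sₛ.-‿cong (≈ₛ-trans (≈ₛ-sym (negArg-xTimes g)) (negArg≈∘ₛ-negX f)))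

    u²≈X*f : u *ₛ u ≈ₛ X *ₛ f
    u²≈X*f = begin
      u *ₛ u                  ≈⟨ *ₛ-cong (X-*ₛ r) (X-*ₛ r) ⟨
      (X *ₛ r) *ₛ (X *ₛ r)    ≈⟨ regroup X r ⟩
      X *ₛ (X *ₛ (r *ₛ r))    ≈⟨ Sₛ.*-congˡ (≈ₛ-trans (Sₛ.*-congˡ r²≈g) (X-*ₛ g)) ⟩
      X *ₛ f                  ∎
      where
      open Relation.Binary.Reasoning.Setoid Sₛ.setoid
      open IntegerCoefficientSolver seriesRing
      regroup : ∀ x e → (x *ₛ e) *ₛ (x *ₛ e) ≈ₛ x *ₛ (x *ₛ (e *ₛ e))
      regroup = solve 2 (λ x e → (x :* e) :* (x :* e) := x :* (x :* (e :* e))) ≈ₛ-refl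

    u∘ₛ-f≈-u : u ∘ₛ (-ₛ f) ≈ₛ -ₛ u
    u∘ₛ-f≈-u = square-root-unique same-square sum₀≈0 sum₁*-half≈1
      where
      open Substitution (-ₛ f) -0#≈0# using (∘ₛ-*ₛ; ∘ₛ-X)
      same-square : (u ∘ₛ (-ₛ f)) *ₛ (u ∘ₛ (-ₛ f)) ≈ₛ (-ₛ u) *ₛ (-ₛ u)
      same-square = begin
        (u ∘ₛ (-ₛ f)) *ₛ (u ∘ₛ (-ₛ f))    ≈⟨ ∘ₛ-*ₛ u u ⟨
        (u *ₛ u) ∘ₛ (-ₛ f)                ≈⟨ ∘ₛ-congˡ (-ₛ f) u²≈X*f ⟩
        (X *ₛ f) ∘ₛ (-ₛ f)                ≈⟨ ∘ₛ-*ₛ X f ⟩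
        (X ∘ₛ (-ₛ f)) *ₛ (f ∘ₛ (-ₛ f))    ≈⟨ *ₛ-cong ∘ₛ-X f∘ₛ-f≈-X ⟩
        (-ₛ f) *ₛ (-ₛ X)                  ≈⟨ neg-neg f X ⟩
        X *ₛ f                            ≈⟨ u²≈X*f ⟨
        u *ₛ u                            ≈⟨ neg-neg u u ⟨
        (-ₛ u) *ₛ (-ₛ u)                  ∎
        where
        open Relation.Binary.Reasoning.Setoid Sₛ.setoid
        open IntegerCoefficientSolver seriesRing
        neg-neg : ∀ a b → (-ₛ a) *ₛ (-ₛ b) ≈ₛ b *ₛ a
        neg-neg = solve 2 (λ a b → (:- a) :* (:- b) := b :* a) ≈ₛ-refl
      sum₀≈0 : ((u ∘ₛ (-ₛ f)) +ₛ (-ₛ u)) 0 ≈ 0#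
      sum₀≈0 = trans (+-congʳ (∘ₛ-head u (-ₛ f))) (-‿inverseʳ 0#)
      sum₁*-half≈1 : ((u ∘ₛ (-ₛ f)) +ₛ (-ₛ u)) 1 * (- half) ≈ 1#
      sum₁*-half≈1 = begin
        ((u ∘ₛ (-ₛ f)) 1 + - u 1) * (- half)   ≈⟨ *-congʳ (+-cong (∘ₛ-coeff₁ u (-ₛ f)) (-‿cong r₀≈1)) ⟩
        (r 0 * - g 0 + - 1#) * (- half)       ≈⟨ *-congʳ (+-congʳ (*-cong r₀≈1 (-‿cong g₀≈1))) ⟩
        (1# * - 1# + - 1#) * (- half)         ≈⟨ *-congʳ (+-congʳ (*-identityˡ _)) ⟩
        (- 1# + - 1#) * (- half)              ≈⟨ sign-flip 1# half ⟩
        (1# + 1#) * half                      ≈⟨ 2*half≈1 ⟩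
        1#                                    ∎
        where
        open Relation.Binary.Reasoning.Setoid setoid
        open IntegerCoefficientSolver R
        sign-flip : ∀ x y → (- x + - x) * (- y) ≈ (x + x) * y
        sign-flip = solve 2 (λ x y → (:- x :+ :- x) :* (:- y) := (x :+ x) :* y) refl

    v∘ₛ-u≈-X : v ∘ₛ (-ₛ u) ≈ₛ -ₛ X
    v∘ₛ-u≈-X = begin
      v ∘ₛ (-ₛ u)            ≈⟨ ∘ₛ-congʳ v u∘ₛ-f≈-u ⟨
      v ∘ₛ (u ∘ₛ (-ₛ f))     ≈⟨ ∘ₛ-assoc refl -0#≈0# v ⟨
      (v ∘ₛ u) ∘ₛ (-ₛ f)     ≈⟨ ∘ₛ-congˡ (-ₛ f) (xh∘ₛxr≈xg r²≈g h∘xr≈r) ⟩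
      f ∘ₛ (-ₛ f)            ≈⟨ f∘ₛ-f≈-X ⟩
      -ₛ X                   ∎
      where open Relation.Binary.Reasoning.Setoid Sₛ.setoid

    r*[h∘ₛ-u]≈1 : r *ₛ (h ∘ₛ (-ₛ u)) ≈ₛ oneₛ
    r*[h∘ₛ-u]≈1 = xTimes-injective (begin
      xTimes (r *ₛ H)        ≈⟨ xTimes-*ₛ r H ⟨
      u *ₛ H                 ≈⟨ ⁻¹-injective -[u*H]≈-X ⟩
      X                      ≈⟨ X≈xTimes-oneₛ ⟩
      xTimes oneₛ            ∎)
      where
      open Relation.Binary.Reasoning.Setoid Sₛ.setoid
      H : Series
      H = h ∘ₛ (-ₛ u)
      -[u*H]≈-X : -ₛ (u *ₛ H) ≈ₛ -ₛ X
      -[u*H]≈-X = begin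
        -ₛ (u *ₛ H)          ≈⟨ -ₛ‿distribˡ-*ₛ u H ⟩
        (-ₛ u) *ₛ H          ≈⟨ Substitution.xTimes-∘ₛ (-ₛ u) -0#≈0# h ⟨
        v ∘ₛ (-ₛ u)          ≈⟨ v∘ₛ-u≈-X ⟩
        -ₛ X                 ∎
      X≈xTimes-oneₛ : X ≈ₛ xTimes oneₛ
      X≈xTimes-oneₛ zero          = refl
      X≈xTimes-oneₛ (suc zero)    = refl
      X≈xTimes-oneₛ (suc (suc n)) = refl

    h*negArg-h≈1 : h *ₛ negArg h ≈ₛ oneₛ
    h*negArg-h≈1 = ∘ₛ-injective refl (trans (*-identityʳ _) r₀≈1) _ _ (begin
      (h *ₛ negArg h) ∘ₛ u             ≈⟨ U.∘ₛ-*ₛ h (negArg h) ⟩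
      (h ∘ₛ u) *ₛ (negArg h ∘ₛ u)      ≈⟨ *ₛ-cong h∘xr≈r (∘ₛ-congˡ u (negArg≈∘ₛ-negX h)) ⟩
      r *ₛ ((h ∘ₛ (-ₛ X)) ∘ₛ u)        ≈⟨ Sₛ.*-congˡ (∘ₛ-assoc -0#≈0# refl h) ⟩
      r *ₛ (h ∘ₛ ((-ₛ X) ∘ₛ u))        ≈⟨ Sₛ.*-congˡ (∘ₛ-congʳ h (negX-∘ₛ u refl)) ⟩
      r *ₛ (h ∘ₛ (-ₛ u))               ≈⟨ r*[h∘ₛ-u]≈1 ⟩
      oneₛ                             ≈⟨ U.∘ₛ-one ⟨
      oneₛ ∘ₛ u                        ∎)
      where
      open Relation.Binary.Reasoning.Setoid Sₛ.setoid
      module U = Substitution u refl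

  even-odd-split : ∀ {half} → (1# + 1#) * half ≈ 1# → ∀ {h} → h 0 ≈ 1# → h *ₛ negArg h ≈ₛ oneₛ →
    ∃ λ s → ∃ λ t → evenCoeffsZero s × t 0 ≈ 1# × (t *ₛ t ≈ₛ (s *ₛ s) +ₛ oneₛ) × (h ≈ₛ s +ₛ t)
  even-odd-split {half} 2*half≈1 {h} h₀≈1 h*h̃≈1 = s , t , s-even , t₀≈1 , t²≈s²+1 , h≈s+t
    where
    open IntegerCoefficientSolver seriesRing
    h̃ ½ s t : Series
    h̃ = negArg h
    ½ = const half
    s = ½ *ₛ (h +ₛ (-ₛ h̃))
    t = ½ *ₛ (h +ₛ h̃)

    ½+½≈1 : ½ +ₛ ½ ≈ₛ oneₛ
    ½+½≈1 zero    = trans (sym (trans (distribʳ half 1# 1#) (+-cong (*-identityˡ _) (*-identityˡ _)))) 2*half≈1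
    ½+½≈1 (suc n) = +-identityʳ 0#

    h≈s+t : h ≈ₛ s +ₛ t
    h≈s+t = ≈ₛ-sym (≈ₛ-trans (halves ½ h h̃) (≈ₛ-trans (*ₛ-cong ½+½≈1 (≈ₛ-refl {h})) (*ₛ-identityˡ h)))
      where
      halves : ∀ c a b → (c *ₛ (a +ₛ (-ₛ b))) +ₛ (c *ₛ (a +ₛ b)) ≈ₛ (c +ₛ c) *ₛ a
      halves = solve 3 (λ c a b → c :* (a :+ :- b) :+ c :* (a :+ b) := (c :+ c) :* a) ≈ₛ-refl

    t₀≈1 : t 0 ≈ 1#
    t₀≈1 = trans (*ₛ-head ½ (h +ₛ h̃)) (trans (*-congˡ (+-cong h₀≈1 h₀≈1)) (trans (*-comm _ _) 2*half≈1))

    t²≈s²+1 : t *ₛ t ≈ₛ (s *ₛ s) +ₛ oneₛ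
    t²≈s²+1 = ≈ₛ-trans (square-difference ½ h h̃)
      (λ n → +-congˡ (trans (*ₛ-cong (*ₛ-cong ½+½≈1 ½+½≈1) h*h̃≈1 n)
                     (trans (*ₛ-identityʳ (oneₛ *ₛ oneₛ) n) (*ₛ-identityˡ oneₛ n))))
      where
      square-difference : ∀ c a b → (c *ₛ (a +ₛ b)) *ₛ (c *ₛ (a +ₛ b))
        ≈ₛ ((c *ₛ (a +ₛ (-ₛ b))) *ₛ (c *ₛ (a +ₛ (-ₛ b)))) +ₛ (((c +ₛ c) *ₛ (c +ₛ c)) *ₛ (a *ₛ b))
      square-difference = solve 3 (λ c a b → (c :* (a :+ b)) :* (c :* (a :+ b))
        := (c :* (a :+ :- b)) :* (c :* (a :+ :- b)) :+ ((c :+ c) :* (c :+ c)) :* (a :* b)) ≈ₛ-refl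

    s-even : evenCoeffsZero s
    s-even m = trans (const-*ₛ half (h +ₛ (-ₛ h̃)) (2 *ℕ m))
      (trans (*-congˡ (trans (+-congˡ (-‿cong h̃≈h)) (-‿inverseʳ _))) (zeroʳ half))
      where
      h̃≈h : h̃ (2 *ℕ m) ≈ h (2 *ℕ m)
      h̃≈h = trans (negArg-coeff h (2 *ℕ m)) (trans (*-congʳ (altSign-even m)) (*-identityˡ _))

lemma2p1 : {c ℓ : Level} (R : CommutativeRing c ℓ) → IsFieldChar0 R →
    let open CommutativeRing R in
    let open FPS R in
    (g : Series) → g 0 ≈ 1# →
    -- pseudo-involution: x g(-x) is the compositional inverse of x g(x)
    ((xTimes g) ∘ₛ (xTimes (negArg g)) ≈ₛ X) →
    ((xTimes (negArg g)) ∘ₛ (xTimes g) ≈ₛ X) →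
    -- r = sqrt(g): constant term 1, square g
    (r : Series) → r 0 ≈ 1# → (r *ₛ r ≈ₛ g) →
    -- h = A-sequence of (1, x r): h(x r(x)) = r(x)
    (h : Series) → (h ∘ₛ (xTimes r) ≈ₛ r) →
    (riordan (xTimes g) ≈ₘ (riordan (xTimes r) ·ₘ riordan (xTimes h)))
    × (h *ₛ negArg h ≈ₛ oneₛ)
    × (∃ λ s → ∃ λ t → evenCoeffsZero s
         × t 0 ≈ 1# × (t *ₛ t ≈ₛ (s *ₛ s) +ₛ oneₛ)
         × (h ≈ₛ s +ₛ t))
-- Only one of the two inverse laws of the pseudo-involution is needed.
lemma2p1 R F g g₀≈1 _ f̄∘f≈x r r₀≈1 r²≈g h h∘xr≈r with PseudoInvolution.two-invertible R F
... | _ , 2*half≈1 =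
  riordan-factorisation r²≈g h∘xr≈r , h*negArg-h≈1 , even-odd-split 2*half≈1 h₀≈1 h*negArg-h≈1
  where
  open CommutativeRing R
  open FPS R
  open PseudoInvolution R
  open Reciprocal 2*half≈1 g₀≈1 f̄∘f≈x r₀≈1 r²≈g h∘xr≈r using (h*negArg-h≈1)
  h₀≈1 : h 0 ≈ 1#
  h₀≈1 = trans (sym (Composition.∘ₛ-head R h (xTimes r))) (trans (h∘xr≈r 0) r₀≈1)
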